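{- Let $T$ be a tile, let $r\in\mathbb{N}^m$, $s\in\mathbb{N}^n$, let $I\subseteq[0,m)$ be a set of rows and $J\subseteq[0,n)$ a set of columns, with complements $\bar I=[0,m)\setminus I$, $\bar J=[0,n)\setminus J$. If $r(I)-s(\bar J)=\xi_{I,J}$, then every $T$-packing $D$ of the $m\times n$ grid with row projection $r$ and column projection $s$ satisfies $|D\cap(I\times J)|=\xi_{I,J}$ and $|D\cap(\bar I\times\bar J)|=0$.
   Context: Grid cells are integer pairs; the $m\times n$ grid is $[0,m)\times[0,n)$. A tile is a finite nonempty set $T$ of cells connected under 4-adjacency ($(i,j)$ adjacent to $(i\pm1,j),(i,j\pm1)$), in canonical position ($\min\{x:(x,y)\in T\}=\min\{y:(x,y)\in T\}=0$). $T+(i,j)=\{(x+i,y+j):(x,y)\in T\}$. A $T$-packing of the $m\times n$ grid is a set $D$ of vectors such that all copies $T+(i,j)$, $(i,j)\in D$, lie in the grid and are pairwise disjoint. Its row and column projections are $r_i=|\{j:(i,j)\in D\}|$ and $s_j=|\{i:(i,j)\in D\}|$. For sets of rows $I$ and columns $J$, $r(I)=\sum_{i\in I}r_i$, $s(J)=\sum_{j\in J}s_j$, and $\xi_{I,J}=\max_D|D\cap(I\times J)|$, the maximum over all $T$-packings $D$ of the $m\times n$ grid (with no restriction on projections). -}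

module Defs where

open import Data.Nat using (ℕ; zero; suc; _+_; _<_)
open import Data.Bool using (Bool; true; false; not; _∧_; T)
open import Data.Fin using (Fin; zero; suc)
open import Data.Product using (_×_; _,_; ∃; ∃-syntax; Σ-syntax)
open import Data.Sum using (_⊎_)
open import Data.List using (List; [])
open import Data.List.Membership.Propositional using (_∈_)
open import Data.Empty using (⊥)
open import Relation.Nullary using (¬_)
open import Relation.Binary.PropositionalEquality using (_≡_)

-- Cells of a tile in canonical position have nonnegative coordinates.
Cell : Set
Cell = ℕ × ℕ

data Adj : Cell → Cell → Set where
  right : ∀ x y → Adj (x , y) (suc x , y)
  left  : ∀ x y → Adj (suc x , y) (x , y)
  up    : ∀ x y → Adj (x , y) (x , suc y)
  down  : ∀ x y → Adj (x , suc y) (x , y)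

data PathIn (S : List Cell) : Cell → Cell → Set where
  here : ∀ {c} → c ∈ S → PathIn S c c
  step : ∀ {c d e} → c ∈ S → Adj c d → PathIn S d e → PathIn S c e

record Tile : Set where
  field
    cells     : List Cell
    nonempty  : ¬ (cells ≡ [])
    connected : ∀ {c d} → c ∈ cells → d ∈ cells → PathIn cells c d
    minX0     : ∃[ y ] ((0 , y) ∈ cells)
    minY0     : ∃[ x ] ((x , 0) ∈ cells)
open Tile public

sumFin : (n : ℕ) → (Fin n → ℕ) → ℕ
sumFin zero    f = 0
sumFin (suc n) f = f zero + sumFin n (λ i → f (suc i))

bit : Bool → ℕ
bit true  = 1
bit false = 0

-- A set of translation vectors, as a subset of [0,m) × [0,n).
-- (Any vector of a packing lies there since the tile contains cells with x = 0 and y = 0.)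
VecSet : ℕ → ℕ → Set
VecSet m n = Fin m → Fin n → Bool

toN : ∀ {k} → Fin k → ℕ
toN = Data.Fin.toℕ

record IsPacking (t : Tile) (m n : ℕ) (D : VecSet m n) : Set where
  field
    inside   : ∀ i j → T (D i j) → ∀ {x y} → (x , y) ∈ cells t →
               (x + toN i < m) × (y + toN j < n)
    disjoint : ∀ i j i' j' → T (D i j) → T (D i' j') → ¬ ((i , j) ≡ (i' , j')) →
               ∀ {x y x' y'} → (x , y) ∈ cells t → (x' , y') ∈ cells t →
               ¬ ((x + toN i ≡ x' + toN i') × (y + toN j ≡ y' + toN j'))

rowProj : ∀ {m n} → VecSet m n → Fin m → ℕ
rowProj {m} {n} D i = sumFin n (λ j → bit (D i j))

colProj : ∀ {m n} → VecSet m n → Fin n → ℕ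
colProj {m} {n} D j = sumFin m (λ i → bit (D i j))

compl : ∀ {k} → (Fin k → Bool) → Fin k → Bool
compl I i = not (I i)

sumOver : ∀ {k} → (Fin k → Bool) → (Fin k → ℕ) → ℕ
sumOver {k} I r = sumFin k (λ i → if' (I i) (r i))
  where
  if' : Bool → ℕ → ℕ
  if' true  a = a
  if' false _ = 0

countIn : ∀ {m n} → VecSet m n → (Fin m → Bool) → (Fin n → Bool) → ℕ
countIn {m} {n} D I J = sumFin m (λ i → sumFin n (λ j → bit (D i j ∧ I i ∧ J j)))

IsXi : Tile → (m n : ℕ) → (Fin m → Bool) → (Fin n → Bool) → ℕ → Set
IsXi t m n I J ξ =
  (Σ[ D ∈ VecSet m n ] (IsPacking t m n D × (countIn D I J ≡ ξ))) ×
  (∀ (D : VecSet m n) → IsPacking t m n D → countIn D I J Data.Nat.≤ ξ)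

-- Counting the packing by rows of I and by columns of J̄ gives
--   r(I) = |D ∩ (I × J)| + |D ∩ (I × J̄)|  and  s(J̄) = |D ∩ (I × J̄)| + |D ∩ (Ī × J̄)|,
-- so the hypothesis r(I) − s(J̄) = ξ says |D ∩ (I × J)| = |D ∩ (Ī × J̄)| + ξ.
-- Since ξ is the maximum of |D ∩ (I × J)|, the term |D ∩ (Ī × J̄)| must vanish.
module Submission where

open import Defs
open import Data.Nat using (ℕ; zero; suc; _+_; _*_; _≤_)
open import Data.Nat.Properties
  using (+-assoc; +-comm; +-identityʳ; *-zeroʳ; *-distribˡ-+; +-cancelˡ-≡; +-cancelʳ-≤;
         n≤0⇒n≡0; +-commutativeSemigroup)
open import Algebra.Properties.CommutativeSemigroup +-commutativeSemigroup
  using (interchange)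
open import Data.Bool using (Bool; true; false; not; _∧_)
open import Data.Fin using (Fin; zero; suc)
open import Data.Product using (_×_; _,_; proj₂)
open import Relation.Binary.PropositionalEquality
open ≡-Reasoning

sumFin-cong : ∀ n {f g : Fin n → ℕ} → (∀ i → f i ≡ g i) → sumFin n f ≡ sumFin n g
sumFin-cong zero    f≗g = refl
sumFin-cong (suc n) f≗g = cong₂ _+_ (f≗g zero) (sumFin-cong n (λ i → f≗g (suc i)))

sumFin-zero : ∀ n → sumFin n (λ _ → 0) ≡ 0
sumFin-zero zero    = refl
sumFin-zero (suc n) = sumFin-zero n

sumFin-+ : ∀ n (f g : Fin n → ℕ) →
           sumFin n (λ i → f i + g i) ≡ sumFin n f + sumFin n g
sumFin-+ zero    f g = refl
sumFin-+ (suc n) f g = begin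
  f zero + g zero + sumFin n (λ i → f (suc i) + g (suc i))
    ≡⟨ cong (f zero + g zero +_) (sumFin-+ n (λ i → f (suc i)) (λ i → g (suc i))) ⟩
  f zero + g zero + (sumFin n (λ i → f (suc i)) + sumFin n (λ i → g (suc i)))
    ≡⟨ interchange (f zero) (g zero) _ _ ⟩
  sumFin (suc n) f + sumFin (suc n) g ∎

sumFin-*ˡ : ∀ n c (f : Fin n → ℕ) → c * sumFin n f ≡ sumFin n (λ i → c * f i)
sumFin-*ˡ zero    c f = *-zeroʳ c
sumFin-*ˡ (suc n) c f = begin
  c * (f zero + sumFin n (λ i → f (suc i)))
    ≡⟨ *-distribˡ-+ c (f zero) _ ⟩
  c * f zero + c * sumFin n (λ i → f (suc i))
    ≡⟨ cong (c * f zero +_) (sumFin-*ˡ n c (λ i → f (suc i))) ⟩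
  sumFin (suc n) (λ i → c * f i) ∎

sumFin-swap : ∀ m n (f : Fin m → Fin n → ℕ) →
              sumFin m (λ i → sumFin n (f i)) ≡ sumFin n (λ j → sumFin m (λ i → f i j))
sumFin-swap zero    n f = sym (sumFin-zero n)
sumFin-swap (suc m) n f = begin
  sumFin n (f zero) + sumFin m (λ i → sumFin n (f (suc i)))
    ≡⟨ cong (sumFin n (f zero) +_) (sumFin-swap m n (λ i → f (suc i))) ⟩
  sumFin n (f zero) + sumFin n (λ j → sumFin m (λ i → f (suc i) j))
    ≡⟨ sym (sumFin-+ n (f zero) _) ⟩
  sumFin n (λ j → sumFin (suc m) (λ i → f i j)) ∎

sumFin²-+ : ∀ m n (f g : Fin m → Fin n → ℕ) →
            sumFin m (λ i → sumFin n (λ j → f i j + g i j)) ≡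
            sumFin m (λ i → sumFin n (f i)) + sumFin m (λ i → sumFin n (g i))
sumFin²-+ m n f g = begin
  sumFin m (λ i → sumFin n (λ j → f i j + g i j))
    ≡⟨ sumFin-cong m (λ i → sumFin-+ n (f i) (g i)) ⟩
  sumFin m (λ i → sumFin n (f i) + sumFin n (g i))
    ≡⟨ sumFin-+ m _ _ ⟩
  sumFin m (λ i → sumFin n (f i)) + sumFin m (λ i → sumFin n (g i)) ∎

sumOver≡sumFin-bit* : ∀ k (I : Fin k → Bool) (r : Fin k → ℕ) →
                      sumOver I r ≡ sumFin k (λ i → bit (I i) * r i)
sumOver≡sumFin-bit* zero    I r = refl
sumOver≡sumFin-bit* (suc k) I r with I zero
... | true  = cong₂ _+_ (sym (+-identityʳ (r zero)))
                        (sumOver≡sumFin-bit* k (λ i → I (suc i)) (λ i → r (suc i)))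
... | false = sumOver≡sumFin-bit* k (λ i → I (suc i)) (λ i → r (suc i))

sumOver-cong : ∀ {k} (I : Fin k → Bool) {r r′ : Fin k → ℕ} →
               (∀ i → r i ≡ r′ i) → sumOver I r ≡ sumOver I r′
sumOver-cong {k} I {r} {r′} r≗r′ = begin
  sumOver I r                         ≡⟨ sumOver≡sumFin-bit* k I r ⟩
  sumFin k (λ i → bit (I i) * r i)    ≡⟨ sumFin-cong k (λ i → cong (bit (I i) *_) (r≗r′ i)) ⟩
  sumFin k (λ i → bit (I i) * r′ i)   ≡⟨ sym (sumOver≡sumFin-bit* k I r′) ⟩
  sumOver I r′ ∎

bit*bit-split-col : ∀ i d j → bit i * bit d ≡ bit (d ∧ i ∧ j) + bit (d ∧ i ∧ not j)
bit*bit-split-col true  true  true  = refl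
bit*bit-split-col true  true  false = refl
bit*bit-split-col true  false j     = refl
bit*bit-split-col false true  j     = refl
bit*bit-split-col false false j     = refl

bit*bit-split-row : ∀ j d i → bit j * bit d ≡ bit (d ∧ i ∧ j) + bit (d ∧ not i ∧ j)
bit*bit-split-row true  true  true  = refl
bit*bit-split-row true  true  false = refl
bit*bit-split-row true  false i     = refl
bit*bit-split-row false true  true  = refl
bit*bit-split-row false true  false = refl
bit*bit-split-row false false i     = refl

module _ {m n : ℕ} (D : VecSet m n) where

  sumOver-rowProj : ∀ I J → sumOver I (rowProj D) ≡ countIn D I J + countIn D I (compl J)
  sumOver-rowProj I J = begin
    sumOver I (rowProj D)
      ≡⟨ sumOver≡sumFin-bit* m I (rowProj D) ⟩
    sumFin m (λ i → bit (I i) * sumFin n (λ j → bit (D i j)))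
      ≡⟨ sumFin-cong m (λ i → sumFin-*ˡ n (bit (I i)) _) ⟩
    sumFin m (λ i → sumFin n (λ j → bit (I i) * bit (D i j)))
      ≡⟨ sumFin-cong m (λ i → sumFin-cong n (λ j → bit*bit-split-col (I i) (D i j) (J j))) ⟩
    sumFin m (λ i → sumFin n (λ j → bit (D i j ∧ I i ∧ J j) + bit (D i j ∧ I i ∧ not (J j))))
      ≡⟨ sumFin²-+ m n _ _ ⟩
    countIn D I J + countIn D I (compl J) ∎

  sumOver-colProj : ∀ I J → sumOver J (colProj D) ≡ countIn D I J + countIn D (compl I) J
  sumOver-colProj I J = begin
    sumOver J (colProj D)
      ≡⟨ sumOver≡sumFin-bit* n J (colProj D) ⟩
    sumFin n (λ j → bit (J j) * sumFin m (λ i → bit (D i j)))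
      ≡⟨ sumFin-cong n (λ j → sumFin-*ˡ m (bit (J j)) _) ⟩
    sumFin n (λ j → sumFin m (λ i → bit (J j) * bit (D i j)))
      ≡⟨ sym (sumFin-swap m n _) ⟩
    sumFin m (λ i → sumFin n (λ j → bit (J j) * bit (D i j)))
      ≡⟨ sumFin-cong m (λ i → sumFin-cong n (λ j → bit*bit-split-row (J j) (D i j) (I i))) ⟩
    sumFin m (λ i → sumFin n (λ j → bit (D i j ∧ I i ∧ J j) + bit (D i j ∧ not (I i) ∧ J j)))
      ≡⟨ sumFin²-+ m n _ _ ⟩
    countIn D I J + countIn D (compl I) J ∎

squeeze : ∀ a b c ξ → a + b ≡ (b + c) + ξ → a ≤ ξ → (a ≡ ξ) × (c ≡ 0)
squeeze a b c ξ eq a≤ξ = a≡ξ , c≡0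
  where
  a≡c+ξ : a ≡ c + ξ
  a≡c+ξ = +-cancelˡ-≡ b a (c + ξ) (begin
    b + a       ≡⟨ +-comm b a ⟩
    a + b       ≡⟨ eq ⟩
    b + c + ξ   ≡⟨ +-assoc b c ξ ⟩
    b + (c + ξ) ∎)

  c≡0 : c ≡ 0
  c≡0 = n≤0⇒n≡0 (+-cancelʳ-≤ ξ c 0 (subst (_≤ ξ) a≡c+ξ a≤ξ))

  a≡ξ : a ≡ ξ
  a≡ξ = trans a≡c+ξ (cong (_+ ξ) c≡0)

lemma1 : (t : Tile) (m n : ℕ) (r : Fin m → ℕ) (s : Fin n → ℕ)
         (I : Fin m → Bool) (J : Fin n → Bool) (ξ : ℕ) →
         IsXi t m n I J ξ →
         sumOver I r ≡ sumOver (compl J) s + ξ →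
         (D : VecSet m n) → IsPacking t m n D →
         (∀ i → rowProj D i ≡ r i) → (∀ j → colProj D j ≡ s j) →
         (countIn D I J ≡ ξ) × (countIn D (compl I) (compl J) ≡ 0)
lemma1 t m n r s I J ξ isXi balance D packing rows cols =
  squeeze (countIn D I J) (countIn D I (compl J)) (countIn D (compl I) (compl J)) ξ
    (begin
      countIn D I J + countIn D I (compl J)  ≡⟨ rowSum ⟩
      sumOver I r                            ≡⟨ balance ⟩
      sumOver (compl J) s + ξ                ≡⟨ cong (_+ ξ) colSum ⟩
      countIn D I (compl J) + countIn D (compl I) (compl J) + ξ ∎)
    (proj₂ isXi D packing)
  where
  rowSum : countIn D I J + countIn D I (compl J) ≡ sumOver I r
  rowSum = trans (sym (sumOver-rowProj D I J)) (sumOver-cong I rows)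

  colSum : sumOver (compl J) s ≡ countIn D I (compl J) + countIn D (compl I) (compl J)
  colSum = trans (sym (sumOver-cong (compl J) cols)) (sumOver-colProj D I (compl J))
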